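{- Let $n\ge4$, $k\ge1$, and let $A$ be an $(n,k)$-matrix. For 2-element subsets $U,V\subset[n]$ define the matrix $A_{U,V}$, indexed by $(k-1)$-octahedra, by $(A_{U,V})_{P,Q}:=A_{U*P,\,V*Q}$. Then, with $\bar x:=\{1,x\}$, the matrix $A_{\bar2,\bar3}+A_{\bar3,\bar2}$ is an $(n,k-1)$-matrix.
   Context: For $l\ge0$, an $l$-octahedron is a tuple $P=P_1*\dots*P_{l+1}$ of 2-element subsets of $[n]$, identified with the set of $l$-faces $\{(1,a_1),\dots,(l+1,a_{l+1})\}$, $a_i\in P_i$, of the complex $[n]^{*l+1}$; for a 2-subset $U$ and an $(l-1)$-octahedron $P$, $U*P$ is the $l$-octahedron $U*P_1*\dots*P_l$. $P,Q$ are vertex-disjoint if $P_i\cap Q_i=\emptyset$ for all $i$; $\oplus$ is symmetric difference of sets of faces. An $(n,l)$-matrix is a $\mathbb{Z}_2$-matrix $A$ indexed by $l$-octahedra that is symmetric, satisfies $A_{P,Q}=0$ for vertex-disjoint $P,Q$, satisfies $A_{P,Q}=A_{X,Q}+A_{Y,Q}$ whenever $P=X\oplus Y$ for $l$-octahedra $X,Y$, and satisfies $\sum A_{P,Q}=1$, summing over unordered pairs $\{P,Q\}$ of $l$-octahedra with $P_i,Q_i\subset[3]$ and $P_i\cap Q_i=\{1\}$ for all $i\in[l+1]$. -}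

module Defs where

open import Data.Nat as ℕ using (ℕ; zero; suc; _+_)
open import Data.Bool using (Bool; true; false; _∧_; _∨_; _xor_; if_then_else_)
import Data.Bool.Properties as BoolP
open import Data.Fin using (Fin; zero; suc; toℕ; _<_; _<?_; _≟_)
open import Data.Fin.Subset using (Subset; ⁅_⁆; _∪_; _∩_; _⊆_; ⊥)
open import Data.Fin.Subset.Properties using (_⊆?_)
open import Data.Vec using (Vec; []; _∷_; lookup; tabulate; toList; zipWith)
open import Data.Vec.Properties using (≡-dec)
open import Data.Bool.ListAction using (and)
open import Data.List using (List; []; _∷_; map; concatMap; filter; foldr; _++_; allFin)
open import Data.Product using (_×_; _,_; uncurry)
open import Relation.Nullary using (yes; no; does)
open import Relation.Nullary.Decidable using (_×-dec_)
open import Relation.Binary.PropositionalEquality using (_≡_; refl)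

-- [n] = {1,…,n} is represented by Fin n, with Fin element i standing for i+1.

record TwoSubset (n : ℕ) : Set where
  constructor ⟨_,_,_⟩
  field
    lo : Fin n
    hi : Fin n
    lo<hi : lo < hi
open TwoSubset public

toSubset : ∀ {n} → TwoSubset n → Subset n
toSubset U = ⁅ lo U ⁆ ∪ ⁅ hi U ⁆

memB : ∀ {n} → Fin n → TwoSubset n → Bool
memB x U = does (x ≟ lo U) ∨ does (x ≟ hi U)

pairsWith : ∀ {n} → Fin n → List (Fin n) → List (TwoSubset n)
pairsWith a [] = []
pairsWith a (b ∷ bs) with a <? b
... | yes p = ⟨ a , b , p ⟩ ∷ pairsWith a bs
... | no _  = pairsWith a bs

allTwoSubsets : ∀ n → List (TwoSubset n)
allTwoSubsets n = concatMap (λ a → pairsWith a (allFin n)) (allFin n)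

-- An l-octahedron P = P₁ * … * P_{l+1}: a vector of l+1 two-element subsets.
Oct : ℕ → ℕ → Set
Oct n l = Vec (TwoSubset n) (suc l)

-- An l-face (1,a₁),…,(l+1,a_{l+1}) of [n]^{*(l+1)}, recorded as the vector (a₁,…,a_{l+1}).
Face : ℕ → ℕ → Set
Face n l = Vec (Fin n) (suc l)

inOct : ∀ {n l} → Oct n l → Face n l → Bool
inOct P f = and (toList (zipWith memB f P))

_*ₒ_ : ∀ {n l} → TwoSubset n → Oct n l → Oct n (suc l)
U *ₒ P = U ∷ P

VertexDisjoint : ∀ {n l} → Oct n l → Oct n l → Set
VertexDisjoint {l = l} P Q =
  (i : Fin (suc l)) → toSubset (lookup P i) ∩ toSubset (lookup Q i) ≡ ⊥

-- Z₂ is represented by Bool with _xor_ as addition.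
Matrix : ℕ → ℕ → Set
Matrix n l = Oct n l → Oct n l → Bool

allVecs : ∀ {A : Set} → List A → (k : ℕ) → List (Vec A k)
allVecs xs zero = [] ∷ []
allVecs xs (suc k) = concatMap (λ x → map (x ∷_) (allVecs xs k)) xs

allOct : ∀ n l → List (Oct n l)
allOct n l = allVecs (allTwoSubsets n) (suc l)

unorderedPairs : ∀ {A : Set} → List A → List (A × A)
unorderedPairs [] = []
unorderedPairs (x ∷ xs) = map (x ,_) xs ++ unorderedPairs xs

[3] : ∀ {n} → Subset n
[3] = tabulate (λ x → toℕ x ℕ.<ᵇ 3)

[1] : ∀ {n} → Subset n
[1] = tabulate (λ x → toℕ x ℕ.≡ᵇ 0)

normCond : ∀ {n l} → Oct n l → Oct n l → Bool
normCond P Q = and (toList (zipWith condᵢ P Q))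
  where
  condᵢ : ∀ {n} → TwoSubset n → TwoSubset n → Bool
  condᵢ U V = does ((toSubset U ⊆? [3]) ×-dec (toSubset V ⊆? [3])
                   ×-dec ≡-dec BoolP._≟_ (toSubset U ∩ toSubset V) [1])

sum₂ : List Bool → Bool
sum₂ = foldr _xor_ false

record IsMatrix (n l : ℕ) (A : Matrix n l) : Set where
  field
    symmetric : ∀ P Q → A P Q ≡ A Q P
    disjoint-zero : ∀ P Q → VertexDisjoint P Q → A P Q ≡ false
    additive : ∀ P X Y Q →
      (∀ (f : Face n l) → inOct P f ≡ (inOct X f xor inOct Y f)) →
      A P Q ≡ (A X Q xor A Y Q)
    normalised :
      sum₂ (map (uncurry A)
                (filter (λ pq → uncurry normCond pq BoolP.≟ true)
                        (unorderedPairs (allOct n l)))) ≡ true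

sub : ∀ {n l} → Matrix n (suc l) → TwoSubset n → TwoSubset n → Matrix n l
sub A U V P Q = A (U *ₒ P) (V *ₒ Q)

_⊕ₘ_ : ∀ {n l} → Matrix n l → Matrix n l → Matrix n l
(A ⊕ₘ B) P Q = A P Q xor B P Q

bar2 : ∀ m → TwoSubset (4 + m)
bar2 m = ⟨ zero , suc zero , ℕ.s≤s ℕ.z≤n ⟩

bar3 : ∀ m → TwoSubset (4 + m)
bar3 m = ⟨ zero , suc (suc zero) , ℕ.s≤s ℕ.z≤n ⟩

-- Symmetry and additivity of B = A_{2̄,3̄} + A_{3̄,2̄} are inherited from A.  If P, Q are
-- vertex-disjoint, both terms of B_{P,Q} equal A_{2̄*Q, {1,4}*P}: write the head 2̄ or 3̄ as the
-- sum of the other two edges of a triangle, one of which is vertex-disjoint from the opposite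
-- head, and use additivity.  For the normalisation: two 2-subsets of [3] meeting exactly in {1}
-- are 2̄ and 3̄, so the pairs in the normalisation sum of A are the {2̄*P, 3̄*Q} with (P,Q) an
-- ordered pair from the normalisation sum of B; the sum of A is thus the ordered sum of
-- A_{2̄*P, 3̄*Q}, and folding it onto unordered pairs {P,Q} gives the normalisation sum of B.
module Submission where

open import Defs
open import Data.Nat using (ℕ; suc; _+_)

open import Algebra.Bundles using (CommutativeRing)
open import Data.Bool using (Bool; true; false; _∧_; _xor_)
open import Data.Bool.Properties
  using (xor-comm; xor-assoc; xor-same; xor-identityʳ; ∧-assoc; ∧-comm; ∧-zeroʳ;
         ∧-distribˡ-xor; ∧-distribʳ-xor; ⇔→≡; xor-∧-commutativeRing)
  renaming (_≟_ to _≟ᵇ_)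
open import Algebra.Properties.CommutativeSemigroup
  (CommutativeRing.+-commutativeSemigroup xor-∧-commutativeRing)
  using () renaming (interchange to xor-interchange)
open import Data.Empty using (⊥-elim)
open import Data.Nat using (_≡ᵇ_; _<ᵇ_; s≤s; z≤n)
open import Data.Fin using (Fin; zero; suc; toℕ; _<_; _<?_; _≟_)
open import Data.Fin.Properties using (<-irrelevant)
open import Data.Fin.Subset using (Subset; ⁅_⁆; _∪_; _∩_; _⊆_; _∈_) renaming (⊥ to ∅)
open import Data.Fin.Subset.Properties
  using (_⊆?_; x∈⁅x⁆; x∈⁅y⁆⇒x≡y; x∈p∪q⁺; x∈p∪q⁻; x∈p∩q⁺; x∈p∩q⁻; ∩-comm; ∪-idem; ∩-idem)
open import Data.List using (List; []; _∷_; map; _++_; concatMap; filter; allFin; tabulate)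
open import Data.List.Properties using (map-tabulate)
open import Data.Product using (_×_; _,_; proj₁; proj₂; uncurry)
open import Data.Sum using (_⊎_; inj₁; inj₂)
open import Data.Vec using (_∷_; []; head; tail) renaming (tabulate to tabulateᵥ)
open import Data.Vec.Properties
  using (≡-dec; lookup⇒[]=; []=⇒lookup; lookup∘tabulate; lookup-replicate; tabulate-cong;
         tabulate∘lookup)
open import Function using (id; mk⇔)
open import Relation.Binary.Definitions using (DecidableEquality)
open import Relation.Binary.PropositionalEquality
open import Relation.Nullary using (Dec; yes; no; does; ¬_)
open import Relation.Nullary.Decidable using (dec-true; map′; _×-dec_)

does⇒ : ∀ {P : Set} (p? : Dec P) → does p? ≡ true → P
does⇒ (yes p) _ = p

∧-xor-∧≡true : ∀ {a b c d} → (a ∧ b) xor (c ∧ d) ≡ true →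
               (a ≡ true × b ≡ true) ⊎ (c ≡ true × d ≡ true)
∧-xor-∧≡true {true}  {true}                  _ = inj₁ (refl , refl)
∧-xor-∧≡true {true}  {false} {true}  {true}  _ = inj₂ (refl , refl)
∧-xor-∧≡true {false} {_}     {true}  {true}  _ = inj₂ (refl , refl)
∧-xor-∧≡true {true}  {false} {true}  {false} ()
∧-xor-∧≡true {true}  {false} {false} {_}     ()
∧-xor-∧≡true {false} {_}     {true}  {false} ()
∧-xor-∧≡true {false} {_}     {false} {_}     ()

-- Sums in ℤ₂ over lists

∑ : ∀ {A : Set} → List A → (A → Bool) → Bool
∑ xs f = sum₂ (map f xs)

module _ {A : Set} where

  ∑-cong : ∀ (xs : List A) {f g : A → Bool} → (∀ x → f x ≡ g x) → ∑ xs f ≡ ∑ xs g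
  ∑-cong []       f≗g = refl
  ∑-cong (x ∷ xs) f≗g = cong₂ _xor_ (f≗g x) (∑-cong xs f≗g)

  ∑-false : ∀ (xs : List A) → ∑ xs (λ _ → false) ≡ false
  ∑-false []       = refl
  ∑-false (_ ∷ xs) = ∑-false xs

  ∑-xor : ∀ (xs : List A) (f g : A → Bool) → ∑ xs (λ x → f x xor g x) ≡ ∑ xs f xor ∑ xs g
  ∑-xor []       f g = refl
  ∑-xor (x ∷ xs) f g =
    trans (cong ((f x xor g x) xor_) (∑-xor xs f g)) (xor-interchange (f x) (g x) (∑ xs f) (∑ xs g))

  ∑-∧ˡ : ∀ (xs : List A) c (f : A → Bool) → ∑ xs (λ x → c ∧ f x) ≡ c ∧ ∑ xs f
  ∑-∧ˡ []       c f = sym (∧-zeroʳ c)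
  ∑-∧ˡ (x ∷ xs) c f =
    trans (cong ((c ∧ f x) xor_) (∑-∧ˡ xs c f)) (sym (∧-distribˡ-xor c (f x) (∑ xs f)))

  ∑-∧ʳ : ∀ (xs : List A) c (f : A → Bool) → ∑ xs (λ x → f x ∧ c) ≡ ∑ xs f ∧ c
  ∑-∧ʳ []       c f = refl
  ∑-∧ʳ (x ∷ xs) c f =
    trans (cong ((f x ∧ c) xor_) (∑-∧ʳ xs c f)) (sym (∧-distribʳ-xor c (f x) (∑ xs f)))

  ∑-++ : ∀ (xs ys : List A) (f : A → Bool) → ∑ (xs ++ ys) f ≡ ∑ xs f xor ∑ ys f
  ∑-++ []       ys f = refl
  ∑-++ (x ∷ xs) ys f = trans (cong (f x xor_) (∑-++ xs ys f)) (sym (xor-assoc (f x) (∑ xs f) (∑ ys f)))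

  ∑-map : ∀ {B : Set} (xs : List B) (g : B → A) (f : A → Bool) → ∑ (map g xs) f ≡ ∑ xs (λ x → f (g x))
  ∑-map []       g f = refl
  ∑-map (x ∷ xs) g f = cong (f (g x) xor_) (∑-map xs g f)

  ∑-concatMap : ∀ {B : Set} (xs : List B) (g : B → List A) (f : A → Bool) →
                ∑ (concatMap g xs) f ≡ ∑ xs (λ x → ∑ (g x) f)
  ∑-concatMap []       g f = refl
  ∑-concatMap (x ∷ xs) g f =
    trans (∑-++ (g x) (concatMap g xs) f) (cong (∑ (g x) f xor_) (∑-concatMap xs g f))

  ∑-filter : ∀ (xs : List A) (p f : A → Bool) →
             sum₂ (map f (filter (λ x → p x ≟ᵇ true) xs)) ≡ ∑ xs (λ x → p x ∧ f x)
  ∑-filter []       p f = refl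
  ∑-filter (x ∷ xs) p f with p x
  ... | true  = cong (f x xor_) (∑-filter xs p f)
  ... | false = ∑-filter xs p f

  ∑-select : (_≟ₐ_ : DecidableEquality A) (xs : List A) (u : A) → ∑ xs (λ x → does (x ≟ₐ u)) ≡ true →
             ∀ (F : A → Bool) → ∑ xs (λ x → does (x ≟ₐ u) ∧ F x) ≡ F u
  ∑-select _≟ₐ_ xs u odd F = begin
    ∑ xs (λ x → does (x ≟ₐ u) ∧ F x)  ≡⟨ ∑-cong xs at-u ⟩
    ∑ xs (λ x → does (x ≟ₐ u) ∧ F u)  ≡⟨ ∑-∧ʳ xs (F u) (λ x → does (x ≟ₐ u)) ⟩
    ∑ xs (λ x → does (x ≟ₐ u)) ∧ F u  ≡⟨ cong (_∧ F u) odd ⟩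
    F u                                ∎
    where
    open ≡-Reasoning
    at-u : ∀ x → does (x ≟ₐ u) ∧ F x ≡ does (x ≟ₐ u) ∧ F u
    at-u x with x ≟ₐ u
    ... | yes refl = refl
    ... | no _     = refl

pairSum : ∀ {A : Set} → List A → (A → A → Bool) → Bool
pairSum xs h = ∑ (unorderedPairs xs) (uncurry h)

fullSum : ∀ {A : Set} → List A → (A → A → Bool) → Bool
fullSum xs h = ∑ xs (λ x → ∑ xs (h x))

module _ {A : Set} where

  pairSum-cong : ∀ (xs : List A) {h h′ : A → A → Bool} → (∀ x y → h x y ≡ h′ x y) →
                 pairSum xs h ≡ pairSum xs h′
  pairSum-cong xs h≗h′ = ∑-cong (unorderedPairs xs) (λ (x , y) → h≗h′ x y)

  pairSum-∷ : ∀ (x : A) xs (h : A → A → Bool) → pairSum (x ∷ xs) h ≡ ∑ xs (h x) xor pairSum xs h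
  pairSum-∷ x xs h =
    trans (∑-++ (map (x ,_) xs) (unorderedPairs xs) (uncurry h))
          (cong (_xor pairSum xs h) (∑-map xs (x ,_) (uncurry h)))

  pairSum-symmetrise : ∀ (xs : List A) (h : A → A → Bool) → (∀ x → h x x ≡ false) →
                       pairSum xs (λ x y → h x y xor h y x) ≡ fullSum xs h
  pairSum-symmetrise []       h diag = refl
  pairSum-symmetrise (x ∷ xs) h diag = begin
    pairSum (x ∷ xs) (λ x y → h x y xor h y x)
      ≡⟨ pairSum-∷ x xs _ ⟩
    ∑ xs (λ y → h x y xor h y x) xor pairSum xs (λ x y → h x y xor h y x)
      ≡⟨ cong₂ _xor_ (∑-xor xs (h x) (λ y → h y x)) (pairSum-symmetrise xs h diag) ⟩
    (∑ xs (h x) xor ∑ xs (λ y → h y x)) xor fullSum xs h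
      ≡⟨ xor-assoc (∑ xs (h x)) _ _ ⟩
    ∑ xs (h x) xor (∑ xs (λ y → h y x) xor fullSum xs h)
      ≡⟨ cong₂ _xor_ (cong (_xor ∑ xs (h x)) (sym (diag x))) (sym (∑-xor xs (λ y → h y x) _)) ⟩
    fullSum (x ∷ xs) h
      ∎
    where open ≡-Reasoning

-- Enumerating 2-subsets and octahedra

∑-allOct-suc : ∀ n l (f : Oct n (suc l) → Bool) →
               ∑ (allOct n (suc l)) f ≡ ∑ (allTwoSubsets n) (λ U → ∑ (allOct n l) (λ P → f (U ∷ P)))
∑-allOct-suc n l f =
  trans (∑-concatMap (allTwoSubsets n) _ f)
        (∑-cong (allTwoSubsets n) (λ U → ∑-map (allOct n l) (U ∷_) f))

∑-allFin-suc : ∀ n (f : Fin (suc n) → Bool) →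
               ∑ (allFin (suc n)) f ≡ f zero xor ∑ (allFin n) (λ i → f (suc i))
∑-allFin-suc n f =
  cong (f zero xor_) (trans (cong (λ is → ∑ is f) (sym (map-tabulate id suc))) (∑-map (allFin n) suc f))

∑-allFin-≟ : ∀ {n} (x : Fin n) → ∑ (allFin n) (λ a → does (a ≟ x)) ≡ true
∑-allFin-≟ {suc n} zero    =
  trans (∑-allFin-suc n (λ a → does (a ≟ zero))) (cong (true xor_) (∑-false (allFin n)))
∑-allFin-≟ {suc n} (suc x) = trans (∑-allFin-suc n (λ a → does (a ≟ suc x))) (∑-allFin-≟ x)

TwoSubset-≡ : ∀ {n} {U V : TwoSubset n} → lo U ≡ lo V → hi U ≡ hi V → U ≡ V
TwoSubset-≡ {U = ⟨ a , b , p ⟩} {⟨ .a , .b , q ⟩} refl refl = cong ⟨ a , b ,_⟩ (<-irrelevant p q)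

_≟₂_ : ∀ {n} → DecidableEquality (TwoSubset n)
U ≟₂ V =
  map′ (uncurry TwoSubset-≡) (λ U≡V → cong lo U≡V , cong hi U≡V) ((lo U ≟ lo V) ×-dec (hi U ≟ hi V))

≟lo∧≟hi≡false : ∀ {n} {a b : Fin n} (W : TwoSubset n) → ¬ a < b →
                does (a ≟ lo W) ∧ does (b ≟ hi W) ≡ false
≟lo∧≟hi≡false {a = a} {b} W a≮b with a ≟ lo W | b ≟ hi W
... | yes refl | yes refl = ⊥-elim (a≮b (lo<hi W))
... | yes _    | no _     = refl
... | no _     | _        = refl

∑-pairsWith-≟₂ : ∀ {n} (a : Fin n) bs (W : TwoSubset n) →
                 ∑ (pairsWith a bs) (λ U → does (U ≟₂ W)) ≡
                 does (a ≟ lo W) ∧ ∑ bs (λ b → does (b ≟ hi W))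
∑-pairsWith-≟₂ a []       W = sym (∧-zeroʳ _)
∑-pairsWith-≟₂ a (b ∷ bs) W with a <? b
... | yes _  = begin
  (does (a ≟ lo W) ∧ does (b ≟ hi W)) xor ∑ (pairsWith a bs) (λ U → does (U ≟₂ W))
    ≡⟨ cong ((does (a ≟ lo W) ∧ does (b ≟ hi W)) xor_) (∑-pairsWith-≟₂ a bs W) ⟩
  (does (a ≟ lo W) ∧ does (b ≟ hi W)) xor (does (a ≟ lo W) ∧ ∑ bs (λ b → does (b ≟ hi W)))
    ≡⟨ sym (∧-distribˡ-xor (does (a ≟ lo W)) (does (b ≟ hi W)) (∑ bs (λ b → does (b ≟ hi W)))) ⟩
  does (a ≟ lo W) ∧ ∑ (b ∷ bs) (λ b → does (b ≟ hi W))
    ∎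
  where open ≡-Reasoning
... | no a≮b = begin
  ∑ (pairsWith a bs) (λ U → does (U ≟₂ W))
    ≡⟨ ∑-pairsWith-≟₂ a bs W ⟩
  does (a ≟ lo W) ∧ ∑ bs (λ b → does (b ≟ hi W))
    ≡⟨ cong (_xor _) (sym (≟lo∧≟hi≡false W a≮b)) ⟩
  (does (a ≟ lo W) ∧ does (b ≟ hi W)) xor (does (a ≟ lo W) ∧ ∑ bs (λ b → does (b ≟ hi W)))
    ≡⟨ sym (∧-distribˡ-xor (does (a ≟ lo W)) (does (b ≟ hi W)) (∑ bs (λ b → does (b ≟ hi W)))) ⟩
  does (a ≟ lo W) ∧ ∑ (b ∷ bs) (λ b → does (b ≟ hi W))
    ∎
  where open ≡-Reasoning

∑-allTwoSubsets-≟₂ : ∀ {n} (W : TwoSubset n) → ∑ (allTwoSubsets n) (λ U → does (U ≟₂ W)) ≡ true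
∑-allTwoSubsets-≟₂ {n} W = begin
  ∑ (allTwoSubsets n) (λ U → does (U ≟₂ W))
    ≡⟨ ∑-concatMap (allFin n) _ _ ⟩
  ∑ (allFin n) (λ a → ∑ (pairsWith a (allFin n)) (λ U → does (U ≟₂ W)))
    ≡⟨ ∑-cong (allFin n) (λ a → trans (∑-pairsWith-≟₂ a (allFin n) W)
                                      (cong (does (a ≟ lo W) ∧_) (∑-allFin-≟ (hi W)))) ⟩
  ∑ (allFin n) (λ a → does (a ≟ lo W) ∧ true)
    ≡⟨ ∑-∧ʳ (allFin n) true _ ⟩
  ∑ (allFin n) (λ a → does (a ≟ lo W)) ∧ true
    ≡⟨ cong (_∧ true) (∑-allFin-≟ (lo W)) ⟩
  true
    ∎
  where open ≡-Reasoning

∑-allOct-select-head : ∀ {n l} (W : TwoSubset n) (f : Oct n (suc l) → Bool) →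
                       ∑ (allOct n (suc l)) (λ X → does (head X ≟₂ W) ∧ f X) ≡
                       ∑ (allOct n l) (λ P → f (W ∷ P))
∑-allOct-select-head {n} {l} W f = begin
  ∑ (allOct n (suc l)) (λ X → does (head X ≟₂ W) ∧ f X)
    ≡⟨ ∑-allOct-suc n l _ ⟩
  ∑ (allTwoSubsets n) (λ U → ∑ (allOct n l) (λ P → does (U ≟₂ W) ∧ f (U ∷ P)))
    ≡⟨ ∑-cong (allTwoSubsets n) (λ U → ∑-∧ˡ (allOct n l) (does (U ≟₂ W)) _) ⟩
  ∑ (allTwoSubsets n) (λ U → does (U ≟₂ W) ∧ ∑ (allOct n l) (λ P → f (U ∷ P)))
    ≡⟨ ∑-select _≟₂_ (allTwoSubsets n) W (∑-allTwoSubsets-≟₂ W) _ ⟩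
  ∑ (allOct n l) (λ P → f (W ∷ P))
    ∎
  where open ≡-Reasoning

module _ {n : ℕ} where

  ∈-TwoSubset⁻ : ∀ {x : Fin n} (U : TwoSubset n) → x ∈ toSubset U → x ≡ lo U ⊎ x ≡ hi U
  ∈-TwoSubset⁻ U x∈U with x∈p∪q⁻ ⁅ lo U ⁆ ⁅ hi U ⁆ x∈U
  ... | inj₁ x∈lo = inj₁ (x∈⁅y⁆⇒x≡y _ x∈lo)
  ... | inj₂ x∈hi = inj₂ (x∈⁅y⁆⇒x≡y _ x∈hi)

  hi∈ : ∀ (U : TwoSubset n) → hi U ∈ toSubset U
  hi∈ U = x∈p∪q⁺ (inj₂ (x∈⁅x⁆ (hi U)))

  TwoSubset-⊆ : ∀ {S : Subset n} (U : TwoSubset n) → lo U ∈ S → hi U ∈ S → toSubset U ⊆ S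
  TwoSubset-⊆ U lo∈S hi∈S x∈U with ∈-TwoSubset⁻ U x∈U
  ... | inj₁ refl = lo∈S
  ... | inj₂ refl = hi∈S

  ∈-tabulate⁻ : ∀ (f : Fin n → Bool) {x : Fin n} → x ∈ tabulateᵥ f → f x ≡ true
  ∈-tabulate⁻ f {x} x∈ = trans (sym (lookup∘tabulate f x)) ([]=⇒lookup x∈)

  ∅∪∅∩∅∪∅ : (∅ ∪ ∅) ∩ (∅ ∪ ∅) ≡ ∅ {n}
  ∅∪∅∩∅∪∅ = trans (cong₂ _∩_ (∪-idem ∅) (∪-idem ∅)) (∩-idem ∅)

  tabulate-false : tabulateᵥ (λ (_ : Fin n) → false) ≡ ∅
  tabulate-false = trans (tabulate-cong (λ i → sym (lookup-replicate i false))) (tabulate∘lookup ∅)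

hi≢zero : ∀ {n} (U : TwoSubset (suc n)) → hi U ≢ zero
hi≢zero ⟨ _ , zero , () ⟩ refl

zero∈⇒lo≡zero : ∀ {n} (U : TwoSubset (suc n)) → zero ∈ toSubset U → lo U ≡ zero
zero∈⇒lo≡zero U 0∈U with ∈-TwoSubset⁻ U 0∈U
... | inj₁ 0≡lo = sym 0≡lo
... | inj₂ 0≡hi = ⊥-elim (hi≢zero U (sym 0≡hi))

∈[1]⇒≡zero : ∀ {n} {x : Fin (suc n)} → x ∈ [1] → x ≡ zero
∈[1]⇒≡zero {x = zero}  _  = refl
∈[1]⇒≡zero {x = suc x} x∈ with ∈-tabulate⁻ (λ y → toℕ y ≡ᵇ 0) x∈
... | ()

∈[3]⇒ : ∀ {n} {x : Fin (3 + n)} → x ∈ [3] → x ≢ zero → x ≡ suc zero ⊎ x ≡ suc (suc zero)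
∈[3]⇒ {x = zero}                _  x≢0 = ⊥-elim (x≢0 refl)
∈[3]⇒ {x = suc zero}            _  _   = inj₁ refl
∈[3]⇒ {x = suc (suc zero)}      _  _   = inj₂ refl
∈[3]⇒ {x = suc (suc (suc x))}   x∈ _   with ∈-tabulate⁻ (λ y → toℕ y <ᵇ 3) x∈
... | ()

VertexSum : ∀ {n} → TwoSubset n → TwoSubset n → TwoSubset n → Set
VertexSum U X Y = ∀ a → memB a U ≡ memB a X xor memB a Y

FaceSum : ∀ {n l} → Oct n l → Oct n l → Oct n l → Set
FaceSum {n} {l} P X Y = ∀ (f : Face n l) → inOct P f ≡ inOct X f xor inOct Y f

module _ {n l : ℕ} where

  FaceSum-∷ˡ : ∀ {U X Y : TwoSubset n} (P : Oct n l) → VertexSum U X Y → FaceSum (U ∷ P) (X ∷ P) (Y ∷ P)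
  FaceSum-∷ˡ {X = X} {Y} P U=X⊕Y (a ∷ f) =
    trans (cong (_∧ inOct P f) (U=X⊕Y a)) (∧-distribʳ-xor (inOct P f) (memB a X) (memB a Y))

  FaceSum-∷ʳ : ∀ (U : TwoSubset n) {P X Y : Oct n l} → FaceSum P X Y → FaceSum (U ∷ P) (U ∷ X) (U ∷ Y)
  FaceSum-∷ʳ U {X = X} {Y} P=X⊕Y (a ∷ f) =
    trans (cong (memB a U ∧_) (P=X⊕Y f)) (∧-distribˡ-xor (memB a U) (inOct X f) (inOct Y f))

  VertexDisjoint-sym : ∀ {P Q : Oct n l} → VertexDisjoint P Q → VertexDisjoint Q P
  VertexDisjoint-sym P∩Q=∅ i = trans (∩-comm _ _) (P∩Q=∅ i)

  VertexDisjoint-∷ : ∀ {U V : TwoSubset n} {P Q : Oct n l} → toSubset U ∩ toSubset V ≡ ∅ →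
                     VertexDisjoint P Q → VertexDisjoint (U ∷ P) (V ∷ Q)
  VertexDisjoint-∷ U∩V=∅ P∩Q=∅ zero    = U∩V=∅
  VertexDisjoint-∷ U∩V=∅ P∩Q=∅ (suc i) = P∩Q=∅ i

module _ {n l : ℕ} {A : Matrix n (suc l)} (isA : IsMatrix n (suc l) A) where
  open IsMatrix isA

  additive-tail : ∀ (U : TwoSubset n) {P X Y : Oct n l} (V : TwoSubset n) (Q : Oct n l) → FaceSum P X Y →
                  A (U ∷ P) (V ∷ Q) ≡ A (U ∷ X) (V ∷ Q) xor A (U ∷ Y) (V ∷ Q)
  additive-tail U V Q P=X⊕Y = additive _ _ _ _ (FaceSum-∷ʳ U P=X⊕Y)

  drop-disjoint-head : ∀ {U X Y V : TwoSubset n} (P Q : Oct n l) → VertexSum U X Y →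
                       toSubset Y ∩ toSubset V ≡ ∅ → VertexDisjoint P Q →
                       A (U ∷ P) (V ∷ Q) ≡ A (X ∷ P) (V ∷ Q)
  drop-disjoint-head {U} {X} {Y} {V} P Q U=X⊕Y Y∩V=∅ P∩Q=∅ = begin
    A (U ∷ P) (V ∷ Q)                          ≡⟨ additive _ _ _ _ (FaceSum-∷ˡ P U=X⊕Y) ⟩
    A (X ∷ P) (V ∷ Q) xor A (Y ∷ P) (V ∷ Q)   ≡⟨ cong (A (X ∷ P) (V ∷ Q) xor_)
                                                       (disjoint-zero _ _ (VertexDisjoint-∷ Y∩V=∅ P∩Q=∅)) ⟩
    A (X ∷ P) (V ∷ Q) xor false                ≡⟨ xor-identityʳ _ ⟩
    A (X ∷ P) (V ∷ Q)                          ∎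
    where open ≡-Reasoning

normSum : ∀ {n l} → Matrix n l → Bool
normSum {n} {l} A =
  sum₂ (map (uncurry A) (filter (λ pq → uncurry normCond pq ≟ᵇ true) (unorderedPairs (allOct n l))))

normSum-pairSum : ∀ {n l} (A : Matrix n l) →
                  normSum A ≡ pairSum (allOct n l) (λ P Q → normCond P Q ∧ A P Q)
normSum-pairSum {n} {l} A = ∑-filter (unorderedPairs (allOct n l)) (uncurry normCond) (uncurry A)

-- The condition on the i-th coordinates in normCond: normCond (U ∷ P) (V ∷ Q) unfolds to
-- does (pairCond? U V) ∧ normCond P Q.
PairCond : ∀ {n} → TwoSubset n → TwoSubset n → Set
PairCond U V = toSubset U ⊆ [3] × toSubset V ⊆ [3] × toSubset U ∩ toSubset V ≡ [1]

pairCond? : ∀ {n} (U V : TwoSubset n) → Dec (PairCond U V)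
pairCond? U V =
  (toSubset U ⊆? [3]) ×-dec (toSubset V ⊆? [3]) ×-dec ≡-dec _≟ᵇ_ (toSubset U ∩ toSubset V) [1]

PairCond-sym : ∀ {n} {U V : TwoSubset n} → PairCond U V → PairCond V U
PairCond-sym (U⊆[3] , V⊆[3] , U∩V≡[1]) = V⊆[3] , U⊆[3] , trans (∩-comm _ _) U∩V≡[1]

-- The case n = 4 + m

module _ (m : ℕ) where

  2̄ 3̄ : TwoSubset (4 + m)
  2̄ = bar2 m
  3̄ = bar3 m

  PairCond-bars : ∀ {U V} → PairCond U V → (U ≡ 2̄ × V ≡ 3̄) ⊎ (U ≡ 3̄ × V ≡ 2̄)
  PairCond-bars {U} {V} (U⊆[3] , V⊆[3] , U∩V≡[1]) = bars (hi-choice U U⊆[3]) (hi-choice V V⊆[3])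
    where
    0∈U∩V : zero ∈ toSubset U ∩ toSubset V
    0∈U∩V = subst (zero ∈_) (sym U∩V≡[1]) (lookup⇒[]= zero [1] refl)

    lo-U : lo U ≡ zero
    lo-U = zero∈⇒lo≡zero U (proj₁ (x∈p∩q⁻ _ _ 0∈U∩V))

    lo-V : lo V ≡ zero
    lo-V = zero∈⇒lo≡zero V (proj₂ (x∈p∩q⁻ _ _ 0∈U∩V))

    hi-distinct : hi U ≢ hi V
    hi-distinct hiU≡hiV = hi≢zero U (∈[1]⇒≡zero (subst (hi U ∈_) U∩V≡[1]
      (x∈p∩q⁺ (hi∈ U , subst (_∈ toSubset V) (sym hiU≡hiV) (hi∈ V)))))

    hi-choice : ∀ W → toSubset W ⊆ [3] → hi W ≡ suc zero ⊎ hi W ≡ suc (suc zero)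
    hi-choice W W⊆[3] = ∈[3]⇒ (W⊆[3] (hi∈ W)) (hi≢zero W)

    bars : hi U ≡ suc zero ⊎ hi U ≡ suc (suc zero) → hi V ≡ suc zero ⊎ hi V ≡ suc (suc zero) →
           (U ≡ 2̄ × V ≡ 3̄) ⊎ (U ≡ 3̄ × V ≡ 2̄)
    bars (inj₁ u) (inj₂ v) = inj₁ (TwoSubset-≡ lo-U u , TwoSubset-≡ lo-V v)
    bars (inj₂ u) (inj₁ v) = inj₂ (TwoSubset-≡ lo-U u , TwoSubset-≡ lo-V v)
    bars (inj₁ u) (inj₁ v) = ⊥-elim (hi-distinct (trans u (sym v)))
    bars (inj₂ u) (inj₂ v) = ⊥-elim (hi-distinct (trans u (sym v)))

  -- Intersections of these concrete 2-subsets compute on the first four vertices; the remaining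
  -- m coordinates are (∅ ∪ ∅) ∩ (∅ ∪ ∅).
  2̄∩3̄≡[1] : toSubset 2̄ ∩ toSubset 3̄ ≡ [1]
  2̄∩3̄≡[1] = cong (λ v → true ∷ false ∷ false ∷ false ∷ v) (trans ∅∪∅∩∅∪∅ (sym tabulate-false))

  PairCond-2̄3̄ : PairCond 2̄ 3̄
  PairCond-2̄3̄ = TwoSubset-⊆ 2̄ (lookup⇒[]= _ _ refl) (lookup⇒[]= _ _ refl) ,
                 TwoSubset-⊆ 3̄ (lookup⇒[]= _ _ refl) (lookup⇒[]= _ _ refl) ,
                 2̄∩3̄≡[1]

  barPair : TwoSubset (4 + m) → TwoSubset (4 + m) → Bool
  barPair U V = (does (U ≟₂ 2̄) ∧ does (V ≟₂ 3̄)) xor (does (U ≟₂ 3̄) ∧ does (V ≟₂ 2̄))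

  PairCond⇒barPair : ∀ U V → PairCond U V → barPair U V ≡ true
  PairCond⇒barPair U V c with PairCond-bars {U} {V} c
  ... | inj₁ (U≡2̄ , V≡3̄) rewrite U≡2̄ | V≡3̄ = refl
  ... | inj₂ (U≡3̄ , V≡2̄) rewrite U≡3̄ | V≡2̄ = refl

  barPair⇒PairCond : ∀ U V → barPair U V ≡ true → PairCond U V
  barPair⇒PairCond U V b with ∧-xor-∧≡true b
  ... | inj₁ (U≟2̄ , V≟3̄) rewrite does⇒ (U ≟₂ 2̄) U≟2̄ | does⇒ (V ≟₂ 3̄) V≟3̄ = PairCond-2̄3̄
  ... | inj₂ (U≟3̄ , V≟2̄) rewrite does⇒ (U ≟₂ 3̄) U≟3̄ | does⇒ (V ≟₂ 2̄) V≟2̄ =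
    PairCond-sym {U = 2̄} {3̄} PairCond-2̄3̄

  pairCond≡barPair : ∀ U V → does (pairCond? U V) ≡ barPair U V
  pairCond≡barPair U V = ⇔→≡ (mk⇔ (λ c → PairCond⇒barPair U V (does⇒ (pairCond? U V) c))
                                 (λ b → dec-true (pairCond? U V) (barPair⇒PairCond U V b)))

  pairCond-sym : ∀ U V → does (pairCond? U V) ≡ does (pairCond? V U)
  pairCond-sym U V = begin
    does (pairCond? U V)          ≡⟨ pairCond≡barPair U V ⟩
    (u₂ ∧ v₃) xor (u₃ ∧ v₂)       ≡⟨ xor-comm (u₂ ∧ v₃) (u₃ ∧ v₂) ⟩
    (u₃ ∧ v₂) xor (u₂ ∧ v₃)       ≡⟨ cong₂ _xor_ (∧-comm u₃ v₂) (∧-comm u₂ v₃) ⟩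
    (v₂ ∧ u₃) xor (v₃ ∧ u₂)       ≡⟨ sym (pairCond≡barPair V U) ⟩
    does (pairCond? V U)          ∎
    where
    open ≡-Reasoning
    u₂ u₃ v₂ v₃ : Bool
    u₂ = does (U ≟₂ 2̄)
    u₃ = does (U ≟₂ 3̄)
    v₂ = does (V ≟₂ 2̄)
    v₃ = does (V ≟₂ 3̄)

  pairCond-irrefl : ∀ U → does (pairCond? U U) ≡ false
  pairCond-irrefl U = begin
    does (pairCond? U U)          ≡⟨ pairCond≡barPair U U ⟩
    (u₂ ∧ u₃) xor (u₃ ∧ u₂)       ≡⟨ cong ((u₂ ∧ u₃) xor_) (∧-comm u₃ u₂) ⟩
    (u₂ ∧ u₃) xor (u₂ ∧ u₃)       ≡⟨ xor-same (u₂ ∧ u₃) ⟩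
    false                         ∎
    where
    open ≡-Reasoning
    u₂ u₃ : Bool
    u₂ = does (U ≟₂ 2̄)
    u₃ = does (U ≟₂ 3̄)

  normCond-sym : ∀ {k} (P Q : Oct (4 + m) k) → normCond P Q ≡ normCond Q P
  normCond-sym (U ∷ [])          (V ∷ [])          = cong (_∧ true) (pairCond-sym U V)
  normCond-sym (U ∷ P@(_ ∷ _)) (V ∷ Q@(_ ∷ _)) = cong₂ _∧_ (pairCond-sym U V) (normCond-sym P Q)

  normCond-irrefl : ∀ {k} (P : Oct (4 + m) k) → normCond P P ≡ false
  normCond-irrefl (U ∷ P) = cong (_∧ _) (pairCond-irrefl U)

  ≟2̄∧≟3̄≡false : ∀ U t → does (U ≟₂ 2̄) ∧ (does (U ≟₂ 3̄) ∧ t) ≡ false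
  ≟2̄∧≟3̄≡false U t with lo U ≟ zero | hi U ≟ suc zero
  ... | yes _ | yes hi≡1 rewrite hi≡1 = refl
  ... | yes _ | no _                  = refl
  ... | no _  | _                     = refl

  -- Named after the paper's 1-based vertices: s₁₄ = {1,4}, i.e. Fin indices 0 and 3.
  s₁₄ s₂₃ s₂₄ s₃₄ : TwoSubset (4 + m)
  s₁₄ = ⟨ zero , suc (suc (suc zero)) , s≤s z≤n ⟩
  s₂₃ = ⟨ suc zero , suc (suc zero) , s≤s (s≤s z≤n) ⟩
  s₂₄ = ⟨ suc zero , suc (suc (suc zero)) , s≤s (s≤s z≤n) ⟩
  s₃₄ = ⟨ suc (suc zero) , suc (suc (suc zero)) , s≤s (s≤s (s≤s z≤n)) ⟩

  2̄≐s₁₄⊕s₂₄ : VertexSum 2̄ s₁₄ s₂₄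
  2̄≐s₁₄⊕s₂₄ zero                      = refl
  2̄≐s₁₄⊕s₂₄ (suc zero)                = refl
  2̄≐s₁₄⊕s₂₄ (suc (suc zero))          = refl
  2̄≐s₁₄⊕s₂₄ (suc (suc (suc zero)))    = refl
  2̄≐s₁₄⊕s₂₄ (suc (suc (suc (suc _)))) = refl

  3̄≐s₁₄⊕s₃₄ : VertexSum 3̄ s₁₄ s₃₄
  3̄≐s₁₄⊕s₃₄ zero                      = refl
  3̄≐s₁₄⊕s₃₄ (suc zero)                = refl
  3̄≐s₁₄⊕s₃₄ (suc (suc zero))          = refl
  3̄≐s₁₄⊕s₃₄ (suc (suc (suc zero)))    = refl
  3̄≐s₁₄⊕s₃₄ (suc (suc (suc (suc _)))) = refl

  3̄≐2̄⊕s₂₃ : VertexSum 3̄ 2̄ s₂₃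
  3̄≐2̄⊕s₂₃ zero                      = refl
  3̄≐2̄⊕s₂₃ (suc zero)                = refl
  3̄≐2̄⊕s₂₃ (suc (suc zero))          = refl
  3̄≐2̄⊕s₂₃ (suc (suc (suc zero)))    = refl
  3̄≐2̄⊕s₂₃ (suc (suc (suc (suc _)))) = refl

  s₂₄∩3̄≡∅ : toSubset s₂₄ ∩ toSubset 3̄ ≡ ∅
  s₂₄∩3̄≡∅ = cong (λ v → false ∷ false ∷ false ∷ false ∷ v) ∅∪∅∩∅∪∅

  s₃₄∩2̄≡∅ : toSubset s₃₄ ∩ toSubset 2̄ ≡ ∅
  s₃₄∩2̄≡∅ = cong (λ v → false ∷ false ∷ false ∷ false ∷ v) ∅∪∅∩∅∪∅

  s₂₃∩s₁₄≡∅ : toSubset s₂₃ ∩ toSubset s₁₄ ≡ ∅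
  s₂₃∩s₁₄≡∅ = cong (λ v → false ∷ false ∷ false ∷ false ∷ v) ∅∪∅∩∅∪∅

  module _ {k : ℕ} {A : Matrix (4 + m) (suc k)} (isA : IsMatrix (4 + m) (suc k) A) where
    open IsMatrix isA
    open ≡-Reasoning

    B : Matrix (4 + m) k
    B = sub A 2̄ 3̄ ⊕ₘ sub A 3̄ 2̄

    B-symmetric : ∀ P Q → B P Q ≡ B Q P
    B-symmetric P Q = trans (cong₂ _xor_ (symmetric (2̄ ∷ P) (3̄ ∷ Q)) (symmetric (3̄ ∷ P) (2̄ ∷ Q)))
                            (xor-comm (A (3̄ ∷ Q) (2̄ ∷ P)) (A (2̄ ∷ Q) (3̄ ∷ P)))

    B-additive : ∀ P X Y Q → FaceSum P X Y → B P Q ≡ B X Q xor B Y Q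
    B-additive P X Y Q P=X⊕Y =
      trans (cong₂ _xor_ (additive-tail isA 2̄ 3̄ Q P=X⊕Y) (additive-tail isA 3̄ 2̄ Q P=X⊕Y))
            (xor-interchange (A (2̄ ∷ X) (3̄ ∷ Q)) (A (2̄ ∷ Y) (3̄ ∷ Q))
                             (A (3̄ ∷ X) (2̄ ∷ Q)) (A (3̄ ∷ Y) (2̄ ∷ Q)))

    B-disjoint-zero : ∀ P Q → VertexDisjoint P Q → B P Q ≡ false
    B-disjoint-zero P Q P∩Q=∅ = begin
      A (2̄ ∷ P) (3̄ ∷ Q) xor A (3̄ ∷ P) (2̄ ∷ Q)       ≡⟨ cong₂ _xor_ first second ⟩
      A (2̄ ∷ Q) (s₁₄ ∷ P) xor A (2̄ ∷ Q) (s₁₄ ∷ P)   ≡⟨ xor-same (A (2̄ ∷ Q) (s₁₄ ∷ P)) ⟩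
      false                                           ∎
      where
      first : A (2̄ ∷ P) (3̄ ∷ Q) ≡ A (2̄ ∷ Q) (s₁₄ ∷ P)
      first = begin
        A (2̄ ∷ P) (3̄ ∷ Q)    ≡⟨ drop-disjoint-head isA {Y = s₂₄} P Q 2̄≐s₁₄⊕s₂₄ s₂₄∩3̄≡∅ P∩Q=∅ ⟩
        A (s₁₄ ∷ P) (3̄ ∷ Q)  ≡⟨ symmetric _ _ ⟩
        A (3̄ ∷ Q) (s₁₄ ∷ P)  ≡⟨ drop-disjoint-head isA {Y = s₂₃} Q P 3̄≐2̄⊕s₂₃ s₂₃∩s₁₄≡∅
                                  (VertexDisjoint-sym {P = P} {Q} P∩Q=∅) ⟩
        A (2̄ ∷ Q) (s₁₄ ∷ P)  ∎
      second : A (3̄ ∷ P) (2̄ ∷ Q) ≡ A (2̄ ∷ Q) (s₁₄ ∷ P)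
      second = trans (drop-disjoint-head isA {Y = s₃₄} P Q 3̄≐s₁₄⊕s₃₄ s₃₄∩2̄≡∅ P∩Q=∅) (symmetric _ _)

    -- w P Q is the contribution of the ordered pair (2̄*P, 3̄*Q) to the normalisation sum of A;
    -- w⁺ records the same contributions as a function of the (k+1)-octahedra.
    w : Oct (4 + m) k → Oct (4 + m) k → Bool
    w P Q = normCond P Q ∧ A (2̄ ∷ P) (3̄ ∷ Q)

    w⁺ : Oct (4 + m) (suc k) → Oct (4 + m) (suc k) → Bool
    w⁺ X Y = does (head X ≟₂ 2̄) ∧ (does (head Y ≟₂ 3̄) ∧ (normCond (tail X) (tail Y) ∧ A X Y))

    w⁺-irrefl : ∀ X → w⁺ X X ≡ false
    w⁺-irrefl (U ∷ P) = ≟2̄∧≟3̄≡false U _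

    fullSum-w⁺ : fullSum (allOct (4 + m) (suc k)) w⁺ ≡ fullSum (allOct (4 + m) k) w
    fullSum-w⁺ = begin
      ∑ Xs (λ X → ∑ Xs (λ Y → does (head X ≟₂ 2̄) ∧ r X Y))
        ≡⟨ ∑-cong Xs (λ X → ∑-∧ˡ Xs (does (head X ≟₂ 2̄)) (r X)) ⟩
      ∑ Xs (λ X → does (head X ≟₂ 2̄) ∧ ∑ Xs (r X))
        ≡⟨ ∑-allOct-select-head 2̄ (λ X → ∑ Xs (r X)) ⟩
      ∑ Ps (λ P → ∑ Xs (r (2̄ ∷ P)))
        ≡⟨ ∑-cong Ps (λ P → ∑-allOct-select-head 3̄ (λ Y → normCond P (tail Y) ∧ A (2̄ ∷ P) Y)) ⟩
      fullSum Ps w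
        ∎
      where
      Xs : List (Oct (4 + m) (suc k))
      Xs = allOct (4 + m) (suc k)
      Ps : List (Oct (4 + m) k)
      Ps = allOct (4 + m) k
      r : Oct (4 + m) (suc k) → Oct (4 + m) (suc k) → Bool
      r X Y = does (head Y ≟₂ 3̄) ∧ (normCond (tail X) (tail Y) ∧ A X Y)

    normSum-A : normSum A ≡ fullSum (allOct (4 + m) k) w
    normSum-A = begin
      normSum A                                                ≡⟨ normSum-pairSum A ⟩
      pairSum Xs (λ X Y → normCond X Y ∧ A X Y)                ≡⟨ pairSum-cong Xs split ⟩
      pairSum Xs (λ X Y → w⁺ X Y xor w⁺ Y X)                   ≡⟨ pairSum-symmetrise Xs w⁺ w⁺-irrefl ⟩
      fullSum Xs w⁺                                            ≡⟨ fullSum-w⁺ ⟩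
      fullSum (allOct (4 + m) k) w                             ∎
      where
      Xs : List (Oct (4 + m) (suc k))
      Xs = allOct (4 + m) (suc k)
      split : ∀ X Y → normCond X Y ∧ A X Y ≡ w⁺ X Y xor w⁺ Y X
      split (U ∷ P) (V ∷ Q) = begin
        (does (pairCond? U V) ∧ normCond P Q) ∧ A (U ∷ P) (V ∷ Q)
          ≡⟨ ∧-assoc (does (pairCond? U V)) _ _ ⟩
        does (pairCond? U V) ∧ t
          ≡⟨ cong (_∧ t) (pairCond≡barPair U V) ⟩
        ((u₂ ∧ v₃) xor (u₃ ∧ v₂)) ∧ t
          ≡⟨ ∧-distribʳ-xor t (u₂ ∧ v₃) (u₃ ∧ v₂) ⟩
        ((u₂ ∧ v₃) ∧ t) xor ((u₃ ∧ v₂) ∧ t)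
          ≡⟨ cong₂ _xor_ (∧-assoc u₂ v₃ t) (trans (cong (_∧ t) (∧-comm u₃ v₂)) (∧-assoc v₂ u₃ t)) ⟩
        (u₂ ∧ (v₃ ∧ t)) xor (v₂ ∧ (u₃ ∧ t))
          ≡⟨ cong (λ t′ → (u₂ ∧ (v₃ ∧ t)) xor (v₂ ∧ (u₃ ∧ t′)))
                  (cong₂ _∧_ (normCond-sym P Q) (symmetric (U ∷ P) (V ∷ Q))) ⟩
        w⁺ (U ∷ P) (V ∷ Q) xor w⁺ (V ∷ Q) (U ∷ P)
          ∎
        where
        t u₂ u₃ v₂ v₃ : Bool
        t  = normCond P Q ∧ A (U ∷ P) (V ∷ Q)
        u₂ = does (U ≟₂ 2̄)
        u₃ = does (U ≟₂ 3̄)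
        v₂ = does (V ≟₂ 2̄)
        v₃ = does (V ≟₂ 3̄)

    normSum-B : normSum B ≡ fullSum (allOct (4 + m) k) w
    normSum-B = begin
      normSum B                                  ≡⟨ normSum-pairSum B ⟩
      pairSum Ps (λ P Q → normCond P Q ∧ B P Q)  ≡⟨ pairSum-cong Ps split ⟩
      pairSum Ps (λ P Q → w P Q xor w Q P)       ≡⟨ pairSum-symmetrise Ps w w-irrefl ⟩
      fullSum Ps w                               ∎
      where
      Ps : List (Oct (4 + m) k)
      Ps = allOct (4 + m) k
      w-irrefl : ∀ P → w P P ≡ false
      w-irrefl P = cong (_∧ A (2̄ ∷ P) (3̄ ∷ P)) (normCond-irrefl P)
      split : ∀ P Q → normCond P Q ∧ B P Q ≡ w P Q xor w Q P
      split P Q = trans (∧-distribˡ-xor (normCond P Q) (A (2̄ ∷ P) (3̄ ∷ Q)) (A (3̄ ∷ P) (2̄ ∷ Q)))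
                        (cong (w P Q xor_) (cong₂ _∧_ (normCond-sym P Q) (symmetric (3̄ ∷ P) (2̄ ∷ Q))))

    B-normalised : normSum B ≡ true
    B-normalised = trans normSum-B (trans (sym normSum-A) normalised)

lemma2p1 : ∀ (m k : ℕ) (A : Matrix (4 + m) (suc k)) → IsMatrix (4 + m) (suc k) A →
    IsMatrix (4 + m) k (sub A (bar2 m) (bar3 m) ⊕ₘ sub A (bar3 m) (bar2 m))
lemma2p1 m k A isA = record
  { symmetric     = B-symmetric m isA
  ; disjoint-zero = B-disjoint-zero m isA
  ; additive      = B-additive m isA
  ; normalised    = B-normalised m isA
  }
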